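{- Let $q\ge 2$, let $S$ be a $q$-constellation with kernel $K$, and let $v$ be a white vertex of $S$ which belongs to $K$. If the degree of $v$ in $K$ is smaller than $q$, then $v$ is admissible in $S$.
   Context: A $(q+1)$-edge-colored graph is a finite connected multigraph with edge colors in $\{0,\dots,q\}$, each vertex incident to exactly one edge of each color; rooted = one color-$0$ edge distinguished and oriented; bipartite = vertices black/white with every edge joining black to white. A $q$-constellation is a connected graph with white vertices, each of degree $q$ with one incident edge of each color $1,\dots,q$, and colored vertices, each carrying a color $i\in\{1,\dots,q\}$ and a cyclic order of its incident edges; each edge has a color $i$ and joins a white vertex to a color-$i$ vertex; one white vertex is the root. The bijection $\Psi$ from rooted bipartite colored graphs to $q$-constellations: orient all edges black to white; contract every color-$0$ edge, merging its endpoints into a white vertex (root edge giving the root); for each $i$ the color-$i$ edges form disjoint directed cycles; replace each cycle on $p$ vertices by a new color-$i$ vertex joined by color-$i$ edges to these $p$ vertices in the cyclic order of the cycle. A white vertex $w$ of $S$ is admissible if the two endpoints of the color-$0$ edge of $\Psi^{ -1}(S)$ contracted into $w$ are joined in $\Psi^{ -1}(S)$ by a path with no color-$0$ edge. The core of $S$ is obtained by repeatedly deleting non-root vertices of degree $1$ with their incident edge. A chain-vertex of the core is a non-root vertex of degree $2$; a core-chain is a path whose internal vertices are chain-vertices and whose endpoints are not. The kernel $K$ is obtained from the core by replacing every core-chain by a single edge. A white vertex of $S$ belongs to $K$ if it lies in the core and is not a chain-vertex. -}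

module Defs where

open import Data.Nat using (ℕ; zero; suc; _+_)
open import Data.Bool using (Bool; true; false; _∧_; not; if_then_else_)
open import Data.Fin using (Fin; _≟_)
open import Data.Fin.Permutation using (Permutation′; _⟨$⟩ʳ_)
open import Data.Product using (Σ; Σ-syntax; ∃; ∃-syntax; _×_; _,_)
open import Data.Sum using (_⊎_; inj₁; inj₂)
open import Relation.Nullary using (¬_; yes; no)
open import Relation.Nullary.Decidable using (⌊_⌋)
open import Relation.Binary.PropositionalEquality using (_≡_; _≢_; refl)
open import Relation.Binary.Definitions using (DecidableEquality)
open import Relation.Binary.Construct.Closure.ReflexiveTransitive using (Star)

count : ∀ {k} → (Fin k → Bool) → ℕ
count {zero}  f = 0
count {suc k} f = (if f Fin.zero then 1 else 0) + count (λ j → f (Fin.suc j))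

iter : ∀ {n} → Permutation′ n → ℕ → Fin n → Fin n
iter π zero    x = x
iter π (suc k) x = π ⟨$⟩ʳ iter π k x

-- White vertices : Fin n (one of them the root).
-- Colors 1..q are indexed by  i : Fin q  (i stands for color i+1).
-- Colored vertices of color i : Fin (m i).
-- Edge of color i at white b goes to colored vertex  nbr i b.
-- The cyclic order of the edges around the colored vertex c of color i
-- is given by the permutation  next i , whose cycles are exactly the
-- fibres of  nbr i  (next i b is the successor of b around nbr i b).

record Constellation (q : ℕ) : Set where
  field
    n    : ℕ
    root : Fin n
    m    : Fin q → ℕ
    nbr  : (i : Fin q) → Fin n → Fin (m i)
    next : Fin q → Permutation′ n

data Vert {q} (S : Constellation q) : Set where
  white   : Fin (Constellation.n S) → Vert S
  colored : (i : Fin q) → Fin (Constellation.m S i) → Vert S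

_≟V_ : ∀ {q} {S : Constellation q} → DecidableEquality (Vert S)
white b ≟V white b' with b ≟ b'
... | yes refl = yes refl
... | no ne = no λ { refl → ne refl }
white b ≟V colored i c = no λ ()
colored i c ≟V white b = no λ ()
colored i c ≟V colored i' c' with i ≟ i'
... | no ne = no λ { refl → ne refl }
... | yes refl with c ≟ c'
...   | yes refl = yes refl
...   | no ne = no λ { refl → ne refl }

data Adj {q} (S : Constellation q) : Vert S → Vert S → Set where
  wc : ∀ b i → Adj S (white b) (colored i (Constellation.nbr S i b))
  cw : ∀ b i → Adj S (colored i (Constellation.nbr S i b)) (white b)

Connected : ∀ {q} → Constellation q → Set
Connected S = ∀ x y → Star (Adj S) x y

IsConstellation : ∀ {q} → Constellation q → Set
IsConstellation {q} S =
    (∀ i b → nbr i (next i ⟨$⟩ʳ b) ≡ nbr i b)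
  × (∀ i b b' → nbr i b ≡ nbr i b' → ∃[ k ] iter (next i) k b ≡ b')
  × Connected S
  where open Constellation S

-- Ψ⁻¹(S) with its colour-0 edges removed.
-- Vertices: (true , b) = black vertex of b, (false , b) = white vertex of b;
-- the colour-0 edge of Ψ⁻¹(S) contracted into b joins (true,b),(false,b).
-- Colour-(i+1) edges join black b to white (next i b) (contracting the
-- colour-0 edges and orienting black→white yields the directed cycles of
-- next i, i.e. the cyclic orders around the colour-(i+1) vertices of S).

data PsiInvEdge≠0 {q} (S : Constellation q) : Bool × Fin (Constellation.n S) → Bool × Fin (Constellation.n S) → Set where
  bw : ∀ i b → PsiInvEdge≠0 S (true , b) (false , Constellation.next S i ⟨$⟩ʳ b)
  wb : ∀ i b → PsiInvEdge≠0 S (false , Constellation.next S i ⟨$⟩ʳ b) (true , b)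

Admissible : ∀ {q} (S : Constellation q) → Fin (Constellation.n S) → Set
Admissible S b = Star (PsiInvEdge≠0 S) (true , b) (false , b)

VSet : ∀ {q} → Constellation q → Set
VSet S = Vert S → Bool

deg : ∀ {q} (S : Constellation q) → VSet S → Vert S → ℕ
deg S A (white b) = count (λ i → A (white b) ∧ A (colored i (Constellation.nbr S i b)))
deg S A (colored i c) = count (λ b → ⌊ Constellation.nbr S i b ≟ c ⌋ ∧ (A (colored i c) ∧ A (white b)))

data DelStep {q} (S : Constellation q) (A : VSet S) : VSet S → Set where
  del : ∀ x → A x ≡ true → x ≢ white (Constellation.root S) → deg S A x ≡ 1 →
        DelStep S A (λ y → A y ∧ not ⌊ x ≟V y ⌋)

allV : ∀ {q} (S : Constellation q) → VSet S
allV S _ = true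

IsCore : ∀ {q} (S : Constellation q) → VSet S → Set
IsCore S A =
    Star (DelStep S) (allV S) A
  × (∀ x → A x ≡ true → x ≢ white (Constellation.root S) → deg S A x ≢ 1)

ChainVertex : ∀ {q} (S : Constellation q) → VSet S → Vert S → Set
ChainVertex S A x = A x ≡ true × x ≢ white (Constellation.root S) × deg S A x ≡ 2

WhiteInKernel : ∀ {q} (S : Constellation q) → VSet S → Fin (Constellation.n S) → Set
WhiteInKernel S A b = A (white b) ≡ true × ¬ ChainVertex S A (white b)

-- Replacing each
-- core-chain by one edge does not change the degree of a non-chain vertex
-- (each kernel edge-end at x is the first edge of a core-chain leaving x;
-- a core-chain from x back to x becomes a loop, counted twice).
kernelDeg : ∀ {q} (S : Constellation q) → VSet S → Vert S → ℕ
kernelDeg = deg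

{-# OPTIONS --safe #-}
module Submission where

-- Follow the deletions that produce the core, maintaining two invariants of the current
-- vertex set: (I) a white vertex with a deleted coloured neighbour is admissible, and
-- (II) every deleted white vertex has a deleted coloured neighbour.  Deleting a white leaf
-- preserves (II) because its degree 1 is below q.  Deleting a coloured leaf c of colour i
-- preserves (I): the white vertices around c other than the surviving one b are deleted,
-- hence admissible, and walking around the colour-i cycle of c in Ψ⁻¹(S), using their
-- colour-0-free paths, joins the black and white ends of b.  In the core, a white vertex of
-- degree < q has lost a coloured neighbour, so (I) applies.

open import Defs
open import Data.Nat using (ℕ; _≤_; _<_; pred; ≤-pred)
open import Data.Fin using (Fin; zero; suc; _≟_)
open import Data.Bool using (Bool; true; false; _∧_; not)
open import Data.Product using (∃-syntax; _,_; proj₁; proj₂)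
open import Data.Sum using (_⊎_; inj₁; inj₂)
open import Data.Empty using (⊥-elim)
open import Function using (_∘_)
open import Relation.Nullary using (yes; no)
open import Relation.Nullary.Decidable using (⌊_⌋; isYes≗does; dec-true)
open import Relation.Binary.PropositionalEquality using (_≡_; _≢_; refl; sym; trans; cong; subst)
open import Relation.Binary.Construct.Closure.ReflexiveTransitive using (Star; ε; _◅_; _◅◅_; reverse)
open import Data.Fin.Permutation using (_⟨$⟩ʳ_)

count≡0⇒false : ∀ {k} (f : Fin k → Bool) → count f ≡ 0 → ∀ i → f i ≡ false
count≡0⇒false {ℕ.suc _} f h i with f zero in e
count≡0⇒false f () i        | true
count≡0⇒false f h zero      | false = e
count≡0⇒false f h (suc i)   | false = count≡0⇒false (f ∘ suc) h i

count≡1⇒unique : ∀ {k} (f : Fin k → Bool) → count f ≡ 1 →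
                 ∀ {a b} → f a ≡ true → f b ≡ true → a ≡ b
count≡1⇒unique {ℕ.suc _} f h {a} {b} fa fb with f zero in e
... | true = trans (at-zero a fa) (sym (at-zero b fb))
  where
  at-zero : ∀ x → f x ≡ true → x ≡ zero
  at-zero zero    _  = refl
  at-zero (suc x) fx with () ← trans (sym fx) (count≡0⇒false (f ∘ suc) (cong pred h) x)
count≡1⇒unique f h {zero}  {_}     fa fb | false with () ← trans (sym fa) e
count≡1⇒unique f h {suc _} {zero}  fa fb | false with () ← trans (sym fb) e
count≡1⇒unique f h {suc _} {suc _} fa fb | false = cong suc (count≡1⇒unique (f ∘ suc) h fa fb)

count<k⇒∃false : ∀ {k} (f : Fin k → Bool) → count f < k → ∃[ i ] f i ≡ false
count<k⇒∃false {ℕ.suc _} f h with f zero in e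
... | false = zero , e
... | true with i , fi ← count<k⇒∃false (f ∘ suc) (≤-pred h) = suc i , fi

∧≡false⇒falseʳ : ∀ {a b} → a ≡ true → a ∧ b ≡ false → b ≡ false
∧≡false⇒falseʳ refl h = h

≡⇒⌊≟⌋≡true : ∀ {k} {u v : Fin k} → u ≡ v → ⌊ u ≟ v ⌋ ≡ true
≡⇒⌊≟⌋≡true {u = u} {v} u≡v = trans (isYes≗does (u ≟ v)) (dec-true (u ≟ v) u≡v)

module _ {q : ℕ} (S : Constellation q) where
  open Constellation S

  _∖_ : VSet S → Vert S → VSet S
  (B ∖ x) y = B y ∧ not ⌊ x ≟V y ⌋

  ∖-false : ∀ B x y → (B ∖ x) y ≡ false → B y ≡ false ⊎ x ≡ y
  ∖-false B x y h with x ≟V y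
  ... | yes x≡y = inj₂ x≡y
  ... | no _ with B y
  ...   | false = inj₁ refl

  Reach : Fin n → Fin n → Set
  Reach b z = Star (PsiInvEdge≠0 S) (true , b) (false , z)

  reach-next : ∀ i {b y} → Reach b y → Admissible S y → Reach b (next i ⟨$⟩ʳ y)
  reach-next i r a = r ◅◅ reverse edge-sym a ◅◅ (bw i _ ◅ ε)
    where
    edge-sym : ∀ {x y} → PsiInvEdge≠0 S x y → PsiInvEdge≠0 S y x
    edge-sym (bw i b) = wb i b
    edge-sym (wb i b) = bw i b

  module _ (wf : IsConstellation S) where
    private
      next-preserves-nbr = proj₁ wf
      fibre-is-orbit     = proj₁ (proj₂ wf)

    iter-preserves-nbr : ∀ i j y → nbr i (iter (next i) j y) ≡ nbr i y
    iter-preserves-nbr i ℕ.zero    y = refl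
    iter-preserves-nbr i (ℕ.suc j) y = trans (next-preserves-nbr i _) (iter-preserves-nbr i j y)

    -- The step y → next y of the cycle is the edge bw i b if y = b, and otherwise goes
    -- back along the colour-0-free path of the admissible vertex y.
    reach-orbit : ∀ i b → (∀ y → nbr i y ≡ nbr i b → y ≢ b → Admissible S y) →
                  ∀ j → Reach b (iter (next i) j (next i ⟨$⟩ʳ b))
    reach-orbit i b others ℕ.zero = bw i b ◅ ε
    reach-orbit i b others (ℕ.suc j) with iter (next i) j (next i ⟨$⟩ʳ b) ≟ b
    ... | yes y≡b  = subst (λ y → Reach b (next i ⟨$⟩ʳ y)) (sym y≡b) (bw i b ◅ ε)
    ... | no y≢b   = reach-next i (reach-orbit i b others j) (others _ same-fibre y≢b)
      where
      same-fibre = trans (iter-preserves-nbr i j _) (next-preserves-nbr i b)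

    admissible-if-fibre-admissible : ∀ i b → (∀ y → nbr i y ≡ nbr i b → y ≢ b → Admissible S y) →
                                     Admissible S b
    admissible-if-fibre-admissible i b others
      with k , returns ← fibre-is-orbit i (next i ⟨$⟩ʳ b) b (next-preserves-nbr i b)
      = subst (Reach b) returns (reach-orbit i b others k)

  record Invariant (B : VSet S) : Set where
    field
      nbr-deleted⇒admissible    : ∀ b i → B (colored i (nbr i b)) ≡ false → Admissible S b
      white-deleted⇒nbr-deleted : ∀ b → B (white b) ≡ false → ∃[ i ] B (colored i (nbr i b)) ≡ false

    white-deleted⇒admissible : ∀ b → B (white b) ≡ false → Admissible S b
    white-deleted⇒admissible b h with i , h′ ← white-deleted⇒nbr-deleted b h = nbr-deleted⇒admissible b i h′

  open Invariant

  invariant-allV : Invariant (allV S)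
  invariant-allV = record { nbr-deleted⇒admissible = λ _ _ (); white-deleted⇒nbr-deleted = λ _ () }

  invariant-delete-white : 2 ≤ q → ∀ {B x} → Invariant B → B (white x) ≡ true → deg S B (white x) ≡ 1 →
                           Invariant (B ∖ white x)
  invariant-delete-white q≥2 {B} {x} I Bx deg≡1 = record
    { nbr-deleted⇒admissible = nbr-deleted
    ; white-deleted⇒nbr-deleted = white-deleted }
    where
    nbr-deleted : ∀ b i → (B ∖ white x) (colored i (nbr i b)) ≡ false → Admissible S b
    nbr-deleted b i h with ∖-false B (white x) _ h
    ... | inj₁ h′ = nbr-deleted⇒admissible I b i h′

    white-deleted : ∀ b → (B ∖ white x) (white b) ≡ false → ∃[ i ] (B ∖ white x) (colored i (nbr i b)) ≡ false
    white-deleted b h with ∖-false B (white x) _ h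
    ... | inj₁ h′ with i , h″ ← white-deleted⇒nbr-deleted I b h′ = i , cong (_∧ _) h″
    ... | inj₂ refl with i , h″ ← count<k⇒∃false _ (subst (_< q) (sym deg≡1) q≥2)
      = i , cong (_∧ _) (∧≡false⇒falseʳ Bx h″)

  invariant-delete-colored : IsConstellation S → ∀ {B i c} → Invariant B → B (colored i c) ≡ true →
                             deg S B (colored i c) ≡ 1 → Invariant (B ∖ colored i c)
  invariant-delete-colored wf {B} {i} {c} I Bc deg≡1 = record
    { nbr-deleted⇒admissible = nbr-deleted
    ; white-deleted⇒nbr-deleted = white-deleted }
    where
    nbr-deleted : ∀ b j → (B ∖ colored i c) (colored j (nbr j b)) ≡ false → Admissible S b
    nbr-deleted b j h with ∖-false B (colored i c) _ h
    ... | inj₁ h′ = nbr-deleted⇒admissible I b j h′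
    ... | inj₂ refl with B (white b) in Bb
    ...   | false = white-deleted⇒admissible I b Bb
    ...   | true  = admissible-if-fibre-admissible wf i b others
      where
      counted : ∀ y → nbr i y ≡ nbr i b → B (white y) ≡ true →
                ⌊ nbr i y ≟ nbr i b ⌋ ∧ (B (colored i (nbr i b)) ∧ B (white y)) ≡ true
      counted y same By rewrite ≡⇒⌊≟⌋≡true same | Bc | By = refl

      -- c has degree 1 and b is a neighbour, so every other white neighbour is already deleted
      others : ∀ y → nbr i y ≡ nbr i b → y ≢ b → Admissible S y
      others y same y≢b with B (white y) in By
      ... | false = white-deleted⇒admissible I y By
      ... | true  = ⊥-elim (y≢b (count≡1⇒unique _ deg≡1 (counted y same By) (counted b refl Bb)))

    white-deleted : ∀ b → (B ∖ colored i c) (white b) ≡ false → ∃[ j ] (B ∖ colored i c) (colored j (nbr j b)) ≡ false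
    white-deleted b h with ∖-false B (colored i c) _ h
    ... | inj₁ h′ with j , h″ ← white-deleted⇒nbr-deleted I b h′ = j , cong (_∧ _) h″

  invariant-deletions : 2 ≤ q → IsConstellation S → ∀ {B B′} → Star (DelStep S) B B′ → Invariant B → Invariant B′
  invariant-deletions q≥2 wf ε I = I
  invariant-deletions q≥2 wf (del (white x) Bx _ deg≡1 ◅ steps) I =
    invariant-deletions q≥2 wf steps (invariant-delete-white q≥2 I Bx deg≡1)
  invariant-deletions q≥2 wf (del (colored i c) Bc _ deg≡1 ◅ steps) I =
    invariant-deletions q≥2 wf steps (invariant-delete-colored wf I Bc deg≡1)

lemma4p6 : (q : ℕ) → 2 ≤ q → (S : Constellation q) → IsConstellation S → (A : VSet S) → IsCore S A → (v : Fin (Constellation.n S)) → WhiteInKernel S A v → kernelDeg S A (white v) < q → Admissible S v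
lemma4p6 q q≥2 S wf A (deletions , _) v (Av , _) deg<q
  with i , lost ← count<k⇒∃false _ deg<q
  = nbr-deleted⇒admissible core-invariant v i (∧≡false⇒falseʳ Av lost)
  where
  open Invariant
  core-invariant : Invariant S A
  core-invariant = invariant-deletions S q≥2 wf deletions (invariant-allV S)
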